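{- Define integer sequences for $N\ge 1$ by $S_{1000}(N)=\frac{3^N-1}{2}$ and the coupled recurrences $S_{909}(1)=1$, $S_{909}(N+1)=S_{727}(N)+2S_{1000}(N)+1$ for $N\ge1$; $S_{727}(1)=1$, $S_{727}(2)=4$, $S_{727}(N+1)=S_{909}(N)+2S_{909}(N-1)+2S_{1000}(N-1)+3$ for $N\ge2$. For the Magnetic Tower of Hanoi with $N\ge1$ disks and posts pre-colored $(S,I,D)=(\mathrm{Red},\mathrm{Neutral},\mathrm{Blue})$, the minimum number of moves to go from the start state to the end state is $S_{727}(N)$.
   Context: The Magnetic Tower of Hanoi (MToH): there are three posts, Source $S$, Intermediate $I$, Destination $D$, and $N$ disks of distinct sizes. Each disk has one face colored Red and the other Blue. A move takes the top disk of one post and places it on top of another post; every move flips the disk, so its up-facing color changes at each move. Size rule: a disk may never be placed on a smaller disk. Magnetic rule: like colors repel, so a disk may be placed on another disk only if the touching faces have different colors; equivalently all disks stacked on a post show the same color facing up. A post pre-colored Red (resp. Blue) only accepts disks with Red (resp. Blue) facing up; a Neutral post imposes no color restriction on its bottom disk (its effective color is determined by the disks currently on it and it is unrestricted again when empty). Start state: all $N$ disks stacked in size order on $S$ with Red facing up. End state: all $N$ disks stacked in size order on $D$ with Blue facing up. -}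

module Defs where

open import Data.Nat using (ℕ; zero; suc; _+_; _*_; _∸_; _^_; _≤_; _<_)
open import Data.Nat.DivMod using (_/_)
open import Data.List using (List; []; _∷_; map; upTo)
open import Data.Product using (_×_; _,_)
open import Data.Maybe using (Maybe; just; nothing)
open import Data.Unit using (⊤)
open import Relation.Binary.PropositionalEquality using (_≡_; _≢_)

-- The integer sequences (indexed from N = 1; the value at 0 is a dummy 0)

S1000 : ℕ → ℕ
S1000 N = (3 ^ N ∸ 1) / 2

mutual
  S909 : ℕ → ℕ
  S909 zero = 0
  S909 (suc zero) = 1
  S909 (suc (suc n)) = S727 (suc n) + 2 * S1000 (suc n) + 1

  S727 : ℕ → ℕ
  S727 zero = 0
  S727 (suc zero) = 1
  S727 (suc (suc zero)) = 4
  S727 (suc (suc (suc n))) =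
    S909 (suc (suc n)) + 2 * S909 (suc n) + 2 * S1000 (suc n) + 3

data Color : Set where
  Red Blue : Color

flip : Color → Color
flip Red = Blue
flip Blue = Red

data Post : Set where
  S I D : Post

-- pre-coloring of the posts: (S, I, D) = (Red, Neutral, Blue)
postColor : Post → Maybe Color
postColor S = just Red
postColor I = nothing
postColor D = just Blue

-- a disk is (size, colour currently facing up)
Disk : Set
Disk = ℕ × Color

-- a post's stack is listed top disk first
Stack : Set
Stack = List Disk

record State : Set where
  constructor ⟨_,_,_⟩
  field
    onS onI onD : Stack
open State public

stackOf : Post → State → Stack
stackOf S st = onS st
stackOf I st = onI st
stackOf D st = onD st

setStack : Post → Stack → State → State
setStack S l ⟨ a , b , c ⟩ = ⟨ l , b , c ⟩
setStack I l ⟨ a , b , c ⟩ = ⟨ a , l , c ⟩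
setStack D l ⟨ a , b , c ⟩ = ⟨ a , b , l ⟩

PostAccepts : Post → Color → Set
PostAccepts p c with postColor p
... | nothing = ⊤
... | just c' = c ≡ c'

-- may a disk (already flipped, with up colour c) be placed on post p with stack l?
-- size rule: strictly smaller than the top disk;
-- magnetic rule: the touching faces differ, i.e. the new disk's bottom face
-- (flip c) differs from the top face of the disk below.
CanPlace : Post → Disk → Stack → Set
CanPlace p (d , c) [] = PostAccepts p c
CanPlace p (d , c) ((e , c') ∷ _) = PostAccepts p c × d < e × flip c ≢ c'

data Move : State → State → Set where
  move : ∀ (st : State) (p q : Post) (d : ℕ) (c : Color) (rest : Stack) →
         p ≢ q →
         stackOf p st ≡ (d , c) ∷ rest →
         CanPlace q (d , flip c) (stackOf q st) →
         Move st (setStack q ((d , flip c) ∷ stackOf q st) (setStack p rest st))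

data Path : State → State → ℕ → Set where
  done : ∀ {s} → Path s s 0
  step : ∀ {s t u k} → Move s t → Path t u k → Path s u (suc k)

-- the tower of N disks (sizes 0 < 1 < … < N-1, smallest on top), all showing colour c
tower : ℕ → Color → Stack
tower N c = map (λ i → (i , c)) (upTo N)

startState : ℕ → State
startState N = ⟨ tower N Red , [] , [] ⟩

endState : ℕ → State
endState N = ⟨ [] , [] , tower N Blue ⟩

MinMoves : State → State → ℕ → Set
MinMoves s t k = Path s t k × (∀ m → Path s t m → k ≤ m)

-- Positions are analysed from the largest disk down: the smaller disks form a game of the same
-- kind, in which post I is forced to the colour of the largest disk if that disk sits on I.
-- For every such environment and every pair of tower positions (post, colour), the minimum number
-- of moves of an n-tower is an ℕ-combination ⟦ towerCost e s g ⟧ n of 1 and five sequences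
-- β₁ … β₅ obeying a linear recurrence, and S727 N is the entry for (S , Red) → (D , Blue).
-- Upper bound: a fixed plan for n + 1 disks alternates tower moves of the n smaller disks with
-- moves of the largest one, and its cost is the recurrence. Lower bound: the potential Φ (the
-- cheapest way to gather the smaller disks somewhere and finish from there, priced by the table
-- finishCost) drops by at most one per move, vanishes at the goal and is at least towerCost at the
-- start. Every fact needed about the two tables is finite and checked by evaluation.

module Submission where

open import Defs
open import Data.Nat using (ℕ; zero; suc; _+_; _*_; _∸_; _^_; _≤_; _<_; s≤s; _≟_; _≤?_)
open import Data.Nat.DivMod using (_/_; m*n/n≡m)
open import Data.Nat.Properties
  using (*-comm; +-mono-≤; *-monoˡ-≤; +-monoˡ-≤; +-identityʳ; <-asym; n<1+n; m<n⇒m<1+n;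
         ≤-refl; ≤-trans; ≤-reflexive; n≤0⇒n≡0; module ≤-Reasoning)
open import Data.Nat.Tactic.RingSolver using (solve-∀)
open import Data.Product using (_×_; _,_; proj₁; proj₂; ∃-syntax)
open import Data.Product.Properties using (≡-dec)
open import Data.Maybe using (Maybe; just; nothing)
open import Data.Unit using (⊤)
open import Data.List using (List; []; _∷_; _++_; [_]; map; upTo)
open import Data.List.Properties
  using (++-identityʳ; ++-conicalˡ; ++-conicalʳ; ∷-injective; ∷ʳ-injective; map-++; upTo-∷ʳ)
open import Data.List.Relation.Unary.All as All using (All; []; _∷_)
open import Data.List.Relation.Unary.All.Properties using (++⁺)
open import Data.List.Relation.Unary.Any using (here; there)
open import Data.List.Membership.Propositional using (_∈_)
open import Data.List.Extrema.Nat using (argmin; f[argmin]≤f[xs]; argmin-all)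
open import Data.Vec using (Vec; replicate) renaming ([] to []ᵛ; _∷_ to _∷ᵛ_)
open import Function using (id)
open import Relation.Nullary using (Dec; yes; no; ¬?; contradiction)
open import Relation.Nullary.Decidable using (map′; _×-dec_; _→-dec_; toWitness)
open import Relation.Binary using (DecidableEquality)
open import Relation.Binary.PropositionalEquality
  using (_≡_; _≢_; _≗_; refl; sym; trans; cong; cong₂; subst; subst₂; ≢-sym; module ≡-Reasoning)

mutual
  β₁ β₂ β₃ β₄ β₅ : ℕ → ℕ
  β₁ zero = 0
  β₁ (suc n) = β₁ n + 2 * β₂ n
  β₂ zero = 0
  β₂ (suc n) = 1 + β₁ n + β₂ n + 2 * β₃ n
  β₃ zero = 0
  β₃ (suc n) = β₁ n + 2 * β₄ n
  β₄ zero = 0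
  β₄ (suc n) = β₃ n + β₄ n
  β₅ zero = 0
  β₅ (suc n) = 1 + 2 * β₁ n + 3 * β₂ n + 2 * β₃ n + 2 * β₄ n

3^n≡1+2*Σβ : ∀ n → 3 ^ n ≡ 1 + 2 * (β₁ n + β₂ n + β₃ n + β₄ n)
3^n≡1+2*Σβ zero = refl
3^n≡1+2*Σβ (suc n) = begin
  3 * 3 ^ n                                   ≡⟨ cong (3 *_) (3^n≡1+2*Σβ n) ⟩
  3 * (1 + 2 * (β₁ n + β₂ n + β₃ n + β₄ n))   ≡⟨ identity (β₁ n) (β₂ n) (β₃ n) (β₄ n) ⟩
  1 + 2 * (β₁ (suc n) + β₂ (suc n) + β₃ (suc n) + β₄ (suc n)) ∎
  where
  open ≡-Reasoning
  identity : ∀ x w u v → 3 * (1 + 2 * (x + w + u + v)) ≡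
                     1 + 2 * ((x + 2 * w) + (1 + x + w + 2 * u) + (x + 2 * v) + (u + v))
  identity = solve-∀

S1000≡Σβ : ∀ n → S1000 n ≡ β₁ n + β₂ n + β₃ n + β₄ n
S1000≡Σβ n = begin
  (3 ^ n ∸ 1) / 2              ≡⟨ cong (λ k → (k ∸ 1) / 2) (3^n≡1+2*Σβ n) ⟩
  (2 * Σ) / 2                  ≡⟨ cong (_/ 2) (*-comm 2 Σ) ⟩
  (Σ * 2) / 2                  ≡⟨ m*n/n≡m Σ 2 ⟩
  Σ                            ∎
  where
  open ≡-Reasoning
  Σ : ℕ
  Σ = β₁ n + β₂ n + β₃ n + β₄ n

mutual
  S909≡β : ∀ n → S909 n ≡ β₁ n + β₂ n + β₃ n
  S909≡β zero = refl
  S909≡β (suc zero) = refl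
  S909≡β (suc (suc n)) =
    closed (β₁ (suc n)) (β₂ (suc n)) (β₃ (suc n)) (β₄ (suc n)) (S727≡β (suc n)) (S1000≡Σβ (suc n))
    where
    closed : ∀ {a b} x w u v → a ≡ x + w → b ≡ x + w + u + v →
             a + 2 * b + 1 ≡ (x + 2 * w) + (1 + x + w + 2 * u) + (x + 2 * v)
    closed x w u v refl refl = identity x w u v
      where
      identity : ∀ x w u v → (x + w) + 2 * (x + w + u + v) + 1 ≡ (x + 2 * w) + (1 + x + w + 2 * u) + (x + 2 * v)
      identity = solve-∀

  S727≡β : ∀ n → S727 n ≡ β₁ n + β₂ n
  S727≡β zero = refl
  S727≡β (suc zero) = refl
  S727≡β (suc (suc zero)) = refl
  S727≡β (suc (suc (suc n))) =
    closed (β₁ (suc n)) (β₂ (suc n)) (β₃ (suc n)) (β₄ (suc n))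
           (S909≡β (suc (suc n))) (S909≡β (suc n)) (S1000≡Σβ (suc n))
    where
    closed : ∀ {a b c} x w u v →
             a ≡ (x + 2 * w) + (1 + x + w + 2 * u) + (x + 2 * v) → b ≡ x + w + u → c ≡ x + w + u + v →
             a + 2 * b + 2 * c + 3 ≡
             (x + 2 * w) + 2 * (1 + x + w + 2 * u) + (1 + (x + 2 * w) + (1 + x + w + 2 * u) + 2 * (x + 2 * v))
    closed x w u v refl refl refl = identity x w u v
      where
      identity : ∀ x w u v →
        (x + 2 * w) + (1 + x + w + 2 * u) + (x + 2 * v) + 2 * (x + w + u) + 2 * (x + w + u + v) + 3 ≡
        (x + 2 * w) + 2 * (1 + x + w + 2 * u) + (1 + (x + 2 * w) + (1 + x + w + 2 * u) + 2 * (x + 2 * v))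
      identity = solve-∀

infixr 6 _⊕_
infix 4 _≤ₐ_ _≤ₐ?_ _≟ₐ_

record Affine : Set where
  no-eta-equality
  pattern
  constructor aff
  field c₀ c₁ c₂ c₃ c₄ c₅ : ℕ
open Affine

⟦_⟧ : Affine → ℕ → ℕ
⟦ aff a b c d e f ⟧ n = a + b * β₁ n + c * β₂ n + d * β₃ n + e * β₄ n + f * β₅ n

0ₐ 1ₐ : Affine
0ₐ = aff 0 0 0 0 0 0
1ₐ = aff 1 0 0 0 0 0

_⊕_ : Affine → Affine → Affine
aff a b c d e f ⊕ aff a′ b′ c′ d′ e′ f′ = aff (a + a′) (b + b′) (c + c′) (d + d′) (e + e′) (f + f′)

shift : Affine → Affine
shift (aff a b c d e f) =
  aff (a + c + f) (b + c + d + 2 * f) (2 * b + c + 3 * f) (2 * c + e + 2 * f) (2 * d + e + 2 * f) 0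

_≤ₐ_ : Affine → Affine → Set
aff a b c d e f ≤ₐ aff a′ b′ c′ d′ e′ f′ = a ≤ a′ × b ≤ b′ × c ≤ c′ × d ≤ d′ × e ≤ e′ × f ≤ f′

_≤ₐ?_ : ∀ f h → Dec (f ≤ₐ h)
aff a b c d e f ≤ₐ? aff a′ b′ c′ d′ e′ f′ =
  a ≤? a′ ×-dec b ≤? b′ ×-dec c ≤? c′ ×-dec d ≤? d′ ×-dec e ≤? e′ ×-dec f ≤? f′

_≟ₐ_ : DecidableEquality Affine
aff a b c d e f ≟ₐ aff a′ b′ c′ d′ e′ f′ =
  map′ (λ { (refl , refl , refl , refl , refl , refl) → refl })
       (λ { refl → refl , refl , refl , refl , refl , refl })
       (a ≟ a′ ×-dec b ≟ b′ ×-dec c ≟ c′ ×-dec d ≟ d′ ×-dec e ≟ e′ ×-dec f ≟ f′)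

⟦⟧-⊕ : ∀ f h n → ⟦ f ⊕ h ⟧ n ≡ ⟦ f ⟧ n + ⟦ h ⟧ n
⟦⟧-⊕ (aff a b c d e f) (aff a′ b′ c′ d′ e′ f′) n =
  identity a b c d e f a′ b′ c′ d′ e′ f′ (β₁ n) (β₂ n) (β₃ n) (β₄ n) (β₅ n)
  where
  identity : ∀ a b c d e f a′ b′ c′ d′ e′ f′ x w u v z →
    (a + a′) + (b + b′) * x + (c + c′) * w + (d + d′) * u + (e + e′) * v + (f + f′) * z ≡
    (a + b * x + c * w + d * u + e * v + f * z) + (a′ + b′ * x + c′ * w + d′ * u + e′ * v + f′ * z)
  identity = solve-∀

⟦⟧-shift : ∀ f n → ⟦ shift f ⟧ n ≡ ⟦ f ⟧ (suc n)
⟦⟧-shift (aff a b c d e f) n = identity a b c d e f (β₁ n) (β₂ n) (β₃ n) (β₄ n) (β₅ n)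
  where
  identity : ∀ a b c d e f x w u v z →
    (a + c + f) + (b + c + d + 2 * f) * x + (2 * b + c + 3 * f) * w + (2 * c + e + 2 * f) * u
      + (2 * d + e + 2 * f) * v + 0 * z ≡
    a + b * (x + 2 * w) + c * (1 + x + w + 2 * u) + d * (x + 2 * v) + e * (u + v)
      + f * (1 + 2 * x + 3 * w + 2 * u + 2 * v)
  identity = solve-∀

⟦⟧-zero : ∀ f → ⟦ f ⟧ 0 ≡ c₀ f
⟦⟧-zero (aff a b c d e f) = identity a b c d e f
  where
  identity : ∀ a b c d e f → a + b * 0 + c * 0 + d * 0 + e * 0 + f * 0 ≡ a
  identity = solve-∀

⟦⟧-mono : ∀ f h → f ≤ₐ h → ∀ n → ⟦ f ⟧ n ≤ ⟦ h ⟧ n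
⟦⟧-mono (aff _ _ _ _ _ _) (aff _ _ _ _ _ _) (a≤ , b≤ , c≤ , d≤ , e≤ , f≤) n =
  +-mono-≤ (+-mono-≤ (+-mono-≤ (+-mono-≤ (+-mono-≤ a≤ (*-monoˡ-≤ (β₁ n) b≤)) (*-monoˡ-≤ (β₂ n) c≤))
    (*-monoˡ-≤ (β₃ n) d≤)) (*-monoˡ-≤ (β₄ n) e≤)) (*-monoˡ-≤ (β₅ n) f≤)

Place : Set
Place = Post × Color

-- A disk may only rest on a disk showing the same colour, so the disks above the largest disk
-- on I must show its colour: an environment is the colour forced on post I, if any.
Env : Set
Env = Maybe Color

constraint : Env → Post → Maybe Color
constraint _ S = just Red
constraint e I = e
constraint _ D = just Blue

Allows : Maybe Color → Color → Set
Allows nothing _ = ⊤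
Allows (just c′) c = c ≡ c′

Accepts : Env → Place → Set
Accepts e (p , c) = Allows (constraint e p) c

-- The environment of the smaller disks when a larger disk occupies the given place.
restrict : Env → Place → Env
restrict e (S , _) = e
restrict _ (I , c) = just c
restrict e (D , _) = e

_≟ᶜ_ : DecidableEquality Color
Red ≟ᶜ Red = yes refl
Red ≟ᶜ Blue = no λ ()
Blue ≟ᶜ Red = no λ ()
Blue ≟ᶜ Blue = yes refl

_≟ᵖ_ : DecidableEquality Post
S ≟ᵖ S = yes refl
S ≟ᵖ I = no λ ()
S ≟ᵖ D = no λ ()
I ≟ᵖ S = no λ ()
I ≟ᵖ I = yes refl
I ≟ᵖ D = no λ ()
D ≟ᵖ S = no λ ()
D ≟ᵖ I = no λ ()
D ≟ᵖ D = yes refl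

Accepts? : ∀ e g → Dec (Accepts e g)
Accepts? e (p , c) with constraint e p
... | nothing = yes _
... | just c′ = c ≟ᶜ c′

flip-≢⇒≡ : ∀ {c c′} → flip c ≢ c′ → c ≡ c′
flip-≢⇒≡ {Red} {Red} _ = refl
flip-≢⇒≡ {Red} {Blue} h = contradiction refl h
flip-≢⇒≡ {Blue} {Red} h = contradiction refl h
flip-≢⇒≡ {Blue} {Blue} _ = refl

flip-≢ : ∀ c → flip c ≢ c
flip-≢ Red ()
flip-≢ Blue ()

constraint-restrict-≢ : ∀ e {p r} c → r ≢ p → constraint (restrict e (p , c)) r ≡ constraint e r
constraint-restrict-≢ e {S} c _ = refl
constraint-restrict-≢ e {D} c _ = refl
constraint-restrict-≢ e {I} {S} c _ = refl
constraint-restrict-≢ e {I} {D} c _ = refl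
constraint-restrict-≢ e {I} {I} c r≢p = contradiction refl r≢p

constraint-restrict-≡ : ∀ e {p c} → Accepts e (p , c) → constraint (restrict e (p , c)) p ≡ just c
constraint-restrict-≡ e {S} refl = refl
constraint-restrict-≡ e {I} _ = refl
constraint-restrict-≡ e {D} refl = refl

accepts-restrict-≢ : ∀ e {p r} c c′ → r ≢ p → Accepts (restrict e (p , c)) (r , c′) ≡ Accepts e (r , c′)
accepts-restrict-≢ e c c′ r≢p = cong (λ m → Allows m c′) (constraint-restrict-≢ e c r≢p)

accepts-restrict-self : ∀ e {g} → Accepts e g → Accepts (restrict e g) g
accepts-restrict-self e a rewrite constraint-restrict-≡ e a = refl

accepts-restrict-same : ∀ e {p c c′} → Accepts e (p , c) → Accepts (restrict e (p , c)) (p , c′) → c′ ≡ c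
accepts-restrict-same e a h rewrite constraint-restrict-≡ e a = h

accepts-restrict⁻ : ∀ e {p c r c′} → Accepts e (p , c) → Accepts (restrict e (p , c)) (r , c′) → Accepts e (r , c′)
accepts-restrict⁻ e {p} {c} {r} {c′} a h with r ≟ᵖ p
... | yes refl rewrite accepts-restrict-same e a h = a
... | no r≢p = subst id (accepts-restrict-≢ e c c′ r≢p) h

accepts-restrict-swap : ∀ e {p q w} c c′ cw → w ≢ p → w ≢ q →
                        Accepts (restrict e (p , c)) (w , cw) → Accepts (restrict e (q , c′)) (w , cw)
accepts-restrict-swap e c c′ cw w≢p w≢q h =
  subst id (sym (accepts-restrict-≢ e c′ cw w≢q)) (subst id (accepts-restrict-≢ e c cw w≢p) h)

∀-Color? : {P : Color → Set} → (∀ c → Dec (P c)) → Dec (∀ c → P c)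
∀-Color? P? = map′ (λ { (r , b) Red → r ; (r , b) Blue → b }) (λ h → h Red , h Blue) (P? Red ×-dec P? Blue)

∀-Post? : {P : Post → Set} → (∀ p → Dec (P p)) → Dec (∀ p → P p)
∀-Post? P? = map′ (λ { (s , i , d) S → s ; (s , i , d) I → i ; (s , i , d) D → d })
                   (λ h → h S , h I , h D) (P? S ×-dec P? I ×-dec P? D)

∀-Place? : {P : Place → Set} → (∀ g → Dec (P g)) → Dec (∀ g → P g)
∀-Place? P? = map′ (λ h (p , c) → h p c) (λ h p c → h (p , c)) (∀-Post? λ p → ∀-Color? λ c → P? (p , c))

∀-Env? : {P : Env → Set} → (∀ e → Dec (P e)) → Dec (∀ e → P e)
∀-Env? P? = map′ (λ { (n , j) nothing → n ; (n , j) (just c) → j c }) (λ h → h nothing , λ c → h (just c))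
                  (P? nothing ×-dec ∀-Color? λ c → P? (just c))

-- A step of a plan for n + 1 disks: move the n smaller disks as a tower, or move the largest disk.
data Step : Set where
  gather : Place → Step
  largest : Post → Step

-- ⟦ towerCost e s g ⟧ n is the number of moves an n-tower needs from place s to place g.
towerCost : Env → Place → Place → Affine
towerCost (just Red) (S , Red) (I , Red) = aff 0 2 2 2 2 0
towerCost (just Red) (S , Red) (D , Blue) = aff 0 1 1 1 1 0
towerCost (just Red) (I , Red) (S , Red) = aff 0 2 2 2 2 0
towerCost (just Red) (I , Red) (D , Blue) = aff 0 1 1 1 1 0
towerCost (just Red) (D , Blue) (S , Red) = aff 0 1 1 1 1 0
towerCost (just Red) (D , Blue) (I , Red) = aff 0 1 1 1 1 0
towerCost (just Blue) (S , Red) (I , Blue) = aff 0 1 1 1 1 0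
towerCost (just Blue) (S , Red) (D , Blue) = aff 0 1 1 1 1 0
towerCost (just Blue) (I , Blue) (S , Red) = aff 0 1 1 1 1 0
towerCost (just Blue) (I , Blue) (D , Blue) = aff 0 2 2 2 2 0
towerCost (just Blue) (D , Blue) (S , Red) = aff 0 1 1 1 1 0
towerCost (just Blue) (D , Blue) (I , Blue) = aff 0 2 2 2 2 0
towerCost nothing (S , Red) (I , Red) = aff 0 1 2 1 0 0
towerCost nothing (S , Red) (I , Blue) = aff 0 1 1 1 0 0
towerCost nothing (S , Red) (D , Blue) = aff 0 1 1 0 0 0
towerCost nothing (I , Red) (S , Red) = aff 0 1 2 1 0 0
towerCost nothing (I , Red) (I , Blue) = aff 0 1 2 1 0 1
towerCost nothing (I , Red) (D , Blue) = aff 0 1 1 1 0 0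
towerCost nothing (I , Blue) (S , Red) = aff 0 1 1 1 0 0
towerCost nothing (I , Blue) (I , Red) = aff 0 1 2 1 0 1
towerCost nothing (I , Blue) (D , Blue) = aff 0 1 2 1 0 0
towerCost nothing (D , Blue) (S , Red) = aff 0 1 1 0 0 0
towerCost nothing (D , Blue) (I , Red) = aff 0 1 1 1 0 0
towerCost nothing (D , Blue) (I , Blue) = aff 0 1 2 1 0 0
towerCost _ _ _ = 0ₐ

-- ⟦ finishCost e g L t ⟧ n prices the way from the largest of n + 1 disks at L, the others
-- stacked at t, to the (n + 1)-tower at g.
finishCost : Env → Place → Place → Place → Affine
finishCost (just Red) (S , Red) (S , Red) (I , Red) = aff 0 2 2 2 2 0
finishCost (just Red) (S , Red) (S , Red) (D , Blue) = aff 0 1 1 1 1 0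
finishCost (just Red) (S , Red) (D , Blue) (I , Red) = aff 1 2 2 2 2 0
finishCost (just Red) (S , Red) (D , Blue) (S , Red) = aff 1 4 4 4 4 0
finishCost (just Red) (S , Red) (D , Blue) (D , Blue) = aff 1 3 3 3 3 0
finishCost (just Red) (S , Red) (I , Red) (S , Red) = aff 2 4 4 4 4 0
finishCost (just Red) (S , Red) (I , Red) (I , Red) = aff 2 6 6 6 6 0
finishCost (just Red) (S , Red) (I , Red) (D , Blue) = aff 2 5 5 5 5 0
finishCost (just Red) (I , Red) (I , Red) (S , Red) = aff 0 2 2 2 2 0
finishCost (just Red) (I , Red) (I , Red) (D , Blue) = aff 0 1 1 1 1 0
finishCost (just Red) (I , Red) (D , Blue) (S , Red) = aff 1 2 2 2 2 0
finishCost (just Red) (I , Red) (D , Blue) (I , Red) = aff 1 4 4 4 4 0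
finishCost (just Red) (I , Red) (D , Blue) (D , Blue) = aff 1 3 3 3 3 0
finishCost (just Red) (I , Red) (S , Red) (I , Red) = aff 2 4 4 4 4 0
finishCost (just Red) (I , Red) (S , Red) (S , Red) = aff 2 6 6 6 6 0
finishCost (just Red) (I , Red) (S , Red) (D , Blue) = aff 2 5 5 5 5 0
finishCost (just Red) (D , Blue) (D , Blue) (S , Red) = aff 0 1 1 1 1 0
finishCost (just Red) (D , Blue) (D , Blue) (I , Red) = aff 0 1 1 1 1 0
finishCost (just Red) (D , Blue) (S , Red) (I , Red) = aff 1 1 1 1 1 0
finishCost (just Red) (D , Blue) (I , Red) (S , Red) = aff 1 1 1 1 1 0
finishCost (just Red) (D , Blue) (I , Red) (I , Red) = aff 1 3 3 3 3 0
finishCost (just Red) (D , Blue) (I , Red) (D , Blue) = aff 1 2 2 2 2 0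
finishCost (just Red) (D , Blue) (S , Red) (S , Red) = aff 1 3 3 3 3 0
finishCost (just Red) (D , Blue) (S , Red) (D , Blue) = aff 1 2 2 2 2 0
finishCost (just Blue) (S , Red) (S , Red) (I , Blue) = aff 0 1 1 1 1 0
finishCost (just Blue) (S , Red) (S , Red) (D , Blue) = aff 0 1 1 1 1 0
finishCost (just Blue) (S , Red) (I , Blue) (D , Blue) = aff 1 1 1 1 1 0
finishCost (just Blue) (S , Red) (D , Blue) (I , Blue) = aff 1 1 1 1 1 0
finishCost (just Blue) (S , Red) (D , Blue) (S , Red) = aff 1 2 2 2 2 0
finishCost (just Blue) (S , Red) (D , Blue) (D , Blue) = aff 1 3 3 3 3 0
finishCost (just Blue) (S , Red) (I , Blue) (S , Red) = aff 1 2 2 2 2 0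
finishCost (just Blue) (S , Red) (I , Blue) (I , Blue) = aff 1 3 3 3 3 0
finishCost (just Blue) (I , Blue) (I , Blue) (S , Red) = aff 0 1 1 1 1 0
finishCost (just Blue) (I , Blue) (I , Blue) (D , Blue) = aff 0 2 2 2 2 0
finishCost (just Blue) (I , Blue) (S , Red) (D , Blue) = aff 1 2 2 2 2 0
finishCost (just Blue) (I , Blue) (S , Red) (S , Red) = aff 1 3 3 3 3 0
finishCost (just Blue) (I , Blue) (S , Red) (I , Blue) = aff 1 4 4 4 4 0
finishCost (just Blue) (I , Blue) (D , Blue) (I , Blue) = aff 2 4 4 4 4 0
finishCost (just Blue) (I , Blue) (D , Blue) (S , Red) = aff 2 5 5 5 5 0
finishCost (just Blue) (I , Blue) (D , Blue) (D , Blue) = aff 2 6 6 6 6 0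
finishCost (just Blue) (D , Blue) (D , Blue) (S , Red) = aff 0 1 1 1 1 0
finishCost (just Blue) (D , Blue) (D , Blue) (I , Blue) = aff 0 2 2 2 2 0
finishCost (just Blue) (D , Blue) (S , Red) (I , Blue) = aff 1 2 2 2 2 0
finishCost (just Blue) (D , Blue) (S , Red) (S , Red) = aff 1 3 3 3 3 0
finishCost (just Blue) (D , Blue) (S , Red) (D , Blue) = aff 1 4 4 4 4 0
finishCost (just Blue) (D , Blue) (I , Blue) (D , Blue) = aff 2 4 4 4 4 0
finishCost (just Blue) (D , Blue) (I , Blue) (S , Red) = aff 2 5 5 5 5 0
finishCost (just Blue) (D , Blue) (I , Blue) (I , Blue) = aff 2 6 6 6 6 0
finishCost nothing (S , Red) (S , Red) (I , Red) = aff 0 1 2 1 0 0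
finishCost nothing (S , Red) (S , Red) (I , Blue) = aff 0 1 1 1 0 0
finishCost nothing (S , Red) (S , Red) (D , Blue) = aff 0 1 1 0 0 0
finishCost nothing (S , Red) (I , Blue) (D , Blue) = aff 1 1 1 0 0 0
finishCost nothing (S , Red) (I , Blue) (S , Red) = aff 1 2 2 1 1 0
finishCost nothing (S , Red) (I , Blue) (I , Blue) = aff 1 3 3 2 2 0
finishCost nothing (S , Red) (D , Blue) (I , Blue) = aff 1 1 1 1 0 0
finishCost nothing (S , Red) (D , Blue) (S , Red) = aff 1 2 2 2 0 0
finishCost nothing (S , Red) (D , Blue) (I , Red) = aff 1 1 2 1 0 0
finishCost nothing (S , Red) (D , Blue) (D , Blue) = aff 1 2 3 2 0 0
finishCost nothing (S , Red) (I , Red) (S , Red) = aff 2 2 2 2 0 0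
finishCost nothing (S , Red) (I , Red) (I , Red) = aff 2 4 4 4 2 0
finishCost nothing (S , Red) (I , Red) (D , Blue) = aff 2 3 3 3 1 0
finishCost nothing (I , Red) (I , Red) (S , Red) = aff 0 2 2 2 2 0
finishCost nothing (I , Red) (I , Red) (D , Blue) = aff 0 1 1 1 1 0
finishCost nothing (I , Red) (D , Blue) (S , Red) = aff 1 2 2 2 2 0
finishCost nothing (I , Red) (D , Blue) (I , Red) = aff 1 3 4 3 2 0
finishCost nothing (I , Red) (D , Blue) (I , Blue) = aff 1 3 3 3 2 0
finishCost nothing (I , Red) (D , Blue) (D , Blue) = aff 1 3 3 2 2 0
finishCost nothing (I , Red) (S , Red) (I , Blue) = aff 2 3 3 3 2 0
finishCost nothing (I , Red) (S , Red) (S , Red) = aff 2 4 4 4 2 0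
finishCost nothing (I , Red) (S , Red) (I , Red) = aff 2 3 4 3 2 0
finishCost nothing (I , Red) (S , Red) (D , Blue) = aff 2 4 5 4 2 0
finishCost nothing (I , Red) (I , Blue) (D , Blue) = aff 3 4 5 4 2 0
finishCost nothing (I , Red) (I , Blue) (S , Red) = aff 3 5 6 5 3 0
finishCost nothing (I , Red) (I , Blue) (I , Blue) = aff 3 6 7 6 4 0
finishCost nothing (I , Blue) (I , Blue) (S , Red) = aff 0 1 1 1 1 0
finishCost nothing (I , Blue) (I , Blue) (D , Blue) = aff 0 2 2 2 2 0
finishCost nothing (I , Blue) (S , Red) (D , Blue) = aff 1 2 2 2 2 0
finishCost nothing (I , Blue) (S , Red) (S , Red) = aff 1 3 3 2 2 0
finishCost nothing (I , Blue) (S , Red) (I , Red) = aff 1 3 3 3 2 0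
finishCost nothing (I , Blue) (S , Red) (I , Blue) = aff 1 3 4 3 2 0
finishCost nothing (I , Blue) (D , Blue) (I , Red) = aff 2 3 3 3 2 0
finishCost nothing (I , Blue) (D , Blue) (S , Red) = aff 2 4 5 4 2 0
finishCost nothing (I , Blue) (D , Blue) (I , Blue) = aff 2 3 4 3 2 0
finishCost nothing (I , Blue) (D , Blue) (D , Blue) = aff 2 4 4 4 2 0
finishCost nothing (I , Blue) (I , Red) (S , Red) = aff 3 4 5 4 2 0
finishCost nothing (I , Blue) (I , Red) (I , Red) = aff 3 6 7 6 4 0
finishCost nothing (I , Blue) (I , Red) (D , Blue) = aff 3 5 6 5 3 0
finishCost nothing (D , Blue) (D , Blue) (S , Red) = aff 0 1 1 0 0 0
finishCost nothing (D , Blue) (D , Blue) (I , Red) = aff 0 1 1 1 0 0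
finishCost nothing (D , Blue) (D , Blue) (I , Blue) = aff 0 1 2 1 0 0
finishCost nothing (D , Blue) (I , Red) (S , Red) = aff 1 1 1 0 0 0
finishCost nothing (D , Blue) (I , Red) (I , Red) = aff 1 3 3 2 2 0
finishCost nothing (D , Blue) (I , Red) (D , Blue) = aff 1 2 2 1 1 0
finishCost nothing (D , Blue) (S , Red) (I , Red) = aff 1 1 1 1 0 0
finishCost nothing (D , Blue) (S , Red) (S , Red) = aff 1 2 3 2 0 0
finishCost nothing (D , Blue) (S , Red) (I , Blue) = aff 1 1 2 1 0 0
finishCost nothing (D , Blue) (S , Red) (D , Blue) = aff 1 2 2 2 0 0
finishCost nothing (D , Blue) (I , Blue) (D , Blue) = aff 2 2 2 2 0 0
finishCost nothing (D , Blue) (I , Blue) (S , Red) = aff 2 3 3 3 1 0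
finishCost nothing (D , Blue) (I , Blue) (I , Blue) = aff 2 4 4 4 2 0
finishCost _ _ _ _ = 0ₐ

towerPlan : Env → Place → Place → List Step
towerPlan (just Red) (I , Red) (S , Red) = gather (S , Red) ∷ largest D ∷ gather (I , Red) ∷ largest S ∷ gather (S , Red) ∷ []
towerPlan (just Red) (D , Blue) (S , Red) = gather (I , Red) ∷ largest S ∷ gather (S , Red) ∷ []
towerPlan (just Red) (S , Red) (I , Red) = gather (I , Red) ∷ largest D ∷ gather (S , Red) ∷ largest I ∷ gather (I , Red) ∷ []
towerPlan (just Red) (D , Blue) (I , Red) = gather (S , Red) ∷ largest I ∷ gather (I , Red) ∷ []
towerPlan (just Red) (S , Red) (D , Blue) = gather (I , Red) ∷ largest D ∷ gather (D , Blue) ∷ []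
towerPlan (just Red) (I , Red) (D , Blue) = gather (S , Red) ∷ largest D ∷ gather (D , Blue) ∷ []
towerPlan (just Blue) (I , Blue) (S , Red) = gather (D , Blue) ∷ largest S ∷ gather (S , Red) ∷ []
towerPlan (just Blue) (D , Blue) (S , Red) = gather (I , Blue) ∷ largest S ∷ gather (S , Red) ∷ []
towerPlan (just Blue) (S , Red) (I , Blue) = gather (D , Blue) ∷ largest I ∷ gather (I , Blue) ∷ []
towerPlan (just Blue) (D , Blue) (I , Blue) = gather (I , Blue) ∷ largest S ∷ gather (D , Blue) ∷ largest I ∷ gather (I , Blue) ∷ []
towerPlan (just Blue) (S , Red) (D , Blue) = gather (I , Blue) ∷ largest D ∷ gather (D , Blue) ∷ []
towerPlan (just Blue) (I , Blue) (D , Blue) = gather (D , Blue) ∷ largest S ∷ gather (I , Blue) ∷ largest D ∷ gather (D , Blue) ∷ []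
towerPlan nothing (I , Red) (S , Red) = gather (S , Red) ∷ largest D ∷ gather (I , Blue) ∷ largest S ∷ gather (S , Red) ∷ []
towerPlan nothing (I , Blue) (S , Red) = gather (D , Blue) ∷ largest S ∷ gather (S , Red) ∷ []
towerPlan nothing (D , Blue) (S , Red) = gather (I , Blue) ∷ largest S ∷ gather (S , Red) ∷ []
towerPlan nothing (S , Red) (I , Red) = gather (I , Blue) ∷ largest D ∷ gather (S , Red) ∷ largest I ∷ gather (I , Red) ∷ []
towerPlan nothing (I , Blue) (I , Red) = gather (D , Blue) ∷ largest S ∷ gather (I , Blue) ∷ largest D ∷ gather (S , Red) ∷ largest I ∷ gather (I , Red) ∷ []
towerPlan nothing (D , Blue) (I , Red) = gather (S , Red) ∷ largest I ∷ gather (I , Red) ∷ []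
towerPlan nothing (S , Red) (I , Blue) = gather (D , Blue) ∷ largest I ∷ gather (I , Blue) ∷ []
towerPlan nothing (I , Red) (I , Blue) = gather (S , Red) ∷ largest D ∷ gather (I , Red) ∷ largest S ∷ gather (D , Blue) ∷ largest I ∷ gather (I , Blue) ∷ []
towerPlan nothing (D , Blue) (I , Blue) = gather (I , Red) ∷ largest S ∷ gather (D , Blue) ∷ largest I ∷ gather (I , Blue) ∷ []
towerPlan nothing (S , Red) (D , Blue) = gather (I , Red) ∷ largest D ∷ gather (D , Blue) ∷ []
towerPlan nothing (I , Red) (D , Blue) = gather (S , Red) ∷ largest D ∷ gather (D , Blue) ∷ []
towerPlan nothing (I , Blue) (D , Blue) = gather (D , Blue) ∷ largest S ∷ gather (I , Red) ∷ largest D ∷ gather (D , Blue) ∷ []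
towerPlan _ _ _ = []

-- The largest disk moves from p to q while the others are stacked on w.
LargestMove : Env → Place → Post → Post → Set
LargestMove e (p , c) w q = q ≢ p × w ≢ p × w ≢ q × Accepts e (q , flip c)

LargestMove? : ∀ e L w q → Dec (LargestMove e L w q)
LargestMove? e (p , c) w q = ¬? (q ≟ᵖ p) ×-dec ¬? (w ≟ᵖ p) ×-dec ¬? (w ≟ᵖ q) ×-dec Accepts? e (q , flip c)

_≟ₗ_ : DecidableEquality Place
_≟ₗ_ = ≡-dec _≟ᵖ_ _≟ᶜ_

-- Runs e L t ps L′ t′: with the largest disk at L and the others stacked at t, the plan ps is
-- legal and ends with the largest disk at L′ and the others stacked at t′.
Runs : Env → Place → Place → List Step → Place → Place → Set
Runs e L t [] L′ t′ = L ≡ L′ × t ≡ t′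
Runs e L t (gather t′ ∷ ps) L″ t″ = Accepts (restrict e L) t′ × Runs e L t′ ps L″ t″
Runs e (p , c) (w , cw) (largest q ∷ ps) L″ t″ = LargestMove e (p , c) w q × Runs e (q , flip c) (w , cw) ps L″ t″

Runs? : ∀ e L t ps L′ t′ → Dec (Runs e L t ps L′ t′)
Runs? e L t [] L′ t′ = L ≟ₗ L′ ×-dec t ≟ₗ t′
Runs? e L t (gather t′ ∷ ps) L″ t″ = Accepts? (restrict e L) t′ ×-dec Runs? e L t′ ps L″ t″
Runs? e (p , c) (w , cw) (largest q ∷ ps) L″ t″ =
  LargestMove? e (p , c) w q ×-dec Runs? e (q , flip c) (w , cw) ps L″ t″

planCost : Env → Place → Place → List Step → Affine
planCost e L t [] = 0ₐ
planCost e L t (gather t′ ∷ ps) = towerCost (restrict e L) t t′ ⊕ planCost e L t′ ps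
planCost e (p , c) t (largest q ∷ ps) = 1ₐ ⊕ planCost e (q , flip c) t ps

towerCost-constant : ∀ e s g → c₀ (towerCost e s g) ≡ 0
towerCost-constant = toWitness {a? = ∀-Env? λ e → ∀-Place? λ s → ∀-Place? λ g → c₀ (towerCost e s g) ≟ 0} _

towerPlan-correct : ∀ e s g → Accepts e s → Accepts e g →
                    Runs e s s (towerPlan e s g) g g × planCost e s s (towerPlan e s g) ≡ shift (towerCost e s g)
towerPlan-correct = toWitness {a? = ∀-Env? λ e → ∀-Place? λ s → ∀-Place? λ g →
  Accepts? e s →-dec Accepts? e g →-dec
  Runs? e s s (towerPlan e s g) g g ×-dec planCost e s s (towerPlan e s g) ≟ₐ shift (towerCost e s g)} _

finishCost-done : ∀ e g → Accepts e g → finishCost e g g g ≡ 0ₐ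
finishCost-done = toWitness {a? = ∀-Env? λ e → ∀-Place? λ g → Accepts? e g →-dec finishCost e g g g ≟ₐ 0ₐ} _

finishCost-split : ∀ e g s t → Accepts e g → Accepts e s → Accepts (restrict e s) t →
                   shift (towerCost e s g) ≤ₐ towerCost (restrict e s) s t ⊕ finishCost e g s t
finishCost-split = toWitness {a? = ∀-Env? λ e → ∀-Place? λ g → ∀-Place? λ s → ∀-Place? λ t →
  Accepts? e g →-dec Accepts? e s →-dec Accepts? (restrict e s) t →-dec
  shift (towerCost e s g) ≤ₐ? towerCost (restrict e s) s t ⊕ finishCost e g s t} _

finishCost-largest : ∀ e g p c w cw q t → Accepts e g → Accepts e (p , c) → Accepts (restrict e (p , c)) (w , cw) →
                     LargestMove e (p , c) w q → Accepts (restrict e (q , flip c)) t →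
                     finishCost e g (p , c) (w , cw) ≤ₐ
                       1ₐ ⊕ towerCost (restrict e (q , flip c)) (w , cw) t ⊕ finishCost e g (q , flip c) t
finishCost-largest = toWitness {a? = ∀-Env? λ e → ∀-Place? λ g → ∀-Post? λ p → ∀-Color? λ c →
  ∀-Post? λ w → ∀-Color? λ cw → ∀-Post? λ q → ∀-Place? λ t →
  Accepts? e g →-dec Accepts? e (p , c) →-dec Accepts? (restrict e (p , c)) (w , cw) →-dec
  LargestMove? e (p , c) w q →-dec Accepts? (restrict e (q , flip c)) t →-dec
  finishCost e g (p , c) (w , cw) ≤ₐ?
    1ₐ ⊕ towerCost (restrict e (q , flip c)) (w , cw) t ⊕ finishCost e g (q , flip c) t} _

Board : Set
Board = Post → Stack

_[_≔_] : Board → Post → Stack → Board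
(b [ p ≔ l ]) r with r ≟ᵖ p
... | yes _ = l
... | no _ = b r

[≔]-≡ : ∀ b p l → (b [ p ≔ l ]) p ≡ l
[≔]-≡ b p l with p ≟ᵖ p
... | yes _ = refl
... | no p≢p = contradiction refl p≢p

[≔]-≢ : ∀ b {p r} l → r ≢ p → (b [ p ≔ l ]) r ≡ b r
[≔]-≢ b {p} {r} l r≢p with r ≟ᵖ p
... | yes r≡p = contradiction r≡p r≢p
... | no _ = refl

only : Post → Disk → Board
only p x = (λ _ → []) [ p ≔ x ∷ [] ]

beneath : Post → Disk → Board → Board
beneath p x b r = b r ++ only p x r

only-≡ : ∀ p x → only p x p ≡ x ∷ []
only-≡ p x = [≔]-≡ _ p (x ∷ [])

only-≢ : ∀ {p r} x → r ≢ p → only p x r ≡ []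
only-≢ x = [≔]-≢ _ (x ∷ [])

beneath-≢ : ∀ {p r} x b → r ≢ p → beneath p x b r ≡ b r
beneath-≢ x b r≢p rewrite only-≢ x r≢p = ++-identityʳ (b _)

towerBoard : ℕ → Place → Board
towerBoard zero _ _ = []
towerBoard (suc n) (p , c) = beneath p (n , c) (towerBoard n (p , c))

Fits : Env → Post → Disk → Stack → Set
Fits e q (d , c) [] = Accepts e (q , c)
Fits e q (d , c) ((d′ , c′) ∷ _) = Accepts e (q , c) × d < d′ × flip c ≢ c′

fits-map : ∀ {e e′ q d c} l → (Accepts e (q , c) → Accepts e′ (q , c)) → Fits e q (d , c) l → Fits e′ q (d , c) l
fits-map [] f h = f h
fits-map (_ ∷ _) f (a , ordered) = f a , ordered

record BoardMove (e : Env) (b b′ : Board) : Set where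
  constructor boardMove
  field
    from to : Post
    size : ℕ
    colour : Color
    below : Stack
    from≢to : from ≢ to
    lifted : b from ≡ (size , colour) ∷ below
    fits : Fits e to (size , flip colour) (b to)
    at-from : b′ from ≡ below
    at-to : b′ to ≡ (size , flip colour) ∷ b to
    elsewhere : ∀ r → r ≢ from → r ≢ to → b′ r ≡ b r

data BoardPath (e : Env) : Board → Board → ℕ → Set where
  done : ∀ {b} → BoardPath e b b 0
  step : ∀ {b b′ b″ k} → BoardMove e b b′ → BoardPath e b′ b″ k → BoardPath e b b″ (suc k)

_++ᵖ_ : ∀ {e b b′ b″ k l} → BoardPath e b b′ k → BoardPath e b′ b″ l → BoardPath e b b″ (k + l)
done ++ᵖ q = q
step m p ++ᵖ q = step m (p ++ᵖ q)

fits-beneath⁺ : ∀ e {p c n q d c′} l → Accepts e (p , c) → d < n →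
                Fits (restrict e (p , c)) q (d , c′) l → Fits e q (d , c′) (l ++ only p (n , c) q)
fits-beneath⁺ e {p} {c} {n} {q} l a d<n h with q ≟ᵖ p
fits-beneath⁺ e {p} {c} {n} [] a d<n h | yes refl
  rewrite accepts-restrict-same e a h = a , d<n , flip-≢ c
fits-beneath⁺ e (_ ∷ _) a d<n (h , ordered) | yes refl = accepts-restrict⁻ e a h , ordered
fits-beneath⁺ e {p} {c} {n} {q} {c′ = c′} l a d<n h | no q≢p rewrite ++-identityʳ l =
  fits-map l (subst id (accepts-restrict-≢ e c c′ q≢p)) h

DiskOK : Env → ℕ → Post → Disk → Set
DiskOK e n r (d , c) = d < n × Accepts e (r , c)

fits-beneath⁻ : ∀ e {p c n q d c′} l → Accepts e (p , c) → All (DiskOK (restrict e (p , c)) n q) l →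
                Fits e q (d , c′) (l ++ only p (n , c) q) → Fits (restrict e (p , c)) q (d , c′) l
fits-beneath⁻ e {p} {c} {n} {q} l a ok h with q ≟ᵖ p
fits-beneath⁻ e {p} {c} [] a ok (_ , _ , magnetic) | yes refl =
  subst (λ x → Accepts (restrict e (p , c)) (p , x)) (sym (flip-≢⇒≡ magnetic)) (accepts-restrict-self e a)
fits-beneath⁻ e {p} {c} (_ ∷ _) a ((_ , a′) ∷ _) (_ , ordered , magnetic) | yes refl =
  subst (λ x → Accepts (restrict e (p , c)) (p , x)) (sym (flip-≢⇒≡ magnetic)) a′ , ordered , magnetic
fits-beneath⁻ e {p} {c} {c′ = c′} l a ok h | no q≢p rewrite ++-identityʳ l =
  fits-map l (subst id (sym (accepts-restrict-≢ e c c′ q≢p))) h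

beneath-nonempty : ∀ p x b → beneath p x b p ≢ []
beneath-nonempty p x b h with trans (sym (only-≡ p x)) (++-conicalʳ (b p) _ h)
... | ()

beneath-injective : ∀ {p x y b₀ b₁} → beneath p x b₀ ≗ beneath p y b₁ → b₀ ≗ b₁ × x ≡ y
beneath-injective {p} {x} {y} {b₀} {b₁} h = b₀≗b₁ , proj₂ at-p
  where
  at-p : b₀ p ≡ b₁ p × x ≡ y
  at-p = ∷ʳ-injective (b₀ p) (b₁ p)
           (subst₂ (λ l l′ → b₀ p ++ l ≡ b₁ p ++ l′) (only-≡ p x) (only-≡ p y) (h p))
  b₀≗b₁ : b₀ ≗ b₁
  b₀≗b₁ r with r ≟ᵖ p
  ... | yes refl = proj₁ at-p
  ... | no r≢p = trans (sym (beneath-≢ x b₀ r≢p)) (trans (h r) (beneath-≢ y b₁ r≢p))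

towerBoard-≢ : ∀ n {p r} c → r ≢ p → towerBoard n (p , c) r ≡ []
towerBoard-≢ zero c _ = refl
towerBoard-≢ (suc n) c r≢p = trans (beneath-≢ (n , c) (towerBoard n _) r≢p) (towerBoard-≢ n c r≢p)

-- Realises e n cfg b: the board b holds n disks, and cfg lists their places from the largest down.
data Realises : Env → (n : ℕ) → Vec Place n → Board → Set where
  empty : ∀ {e b} → (∀ r → b r ≡ []) → Realises e zero []ᵛ b
  onto : ∀ {e n p c cfg b₀ b} → Accepts e (p , c) → Realises (restrict e (p , c)) n cfg b₀ →
         b ≗ beneath p (n , c) b₀ → Realises e (suc n) ((p , c) ∷ᵛ cfg) b

realises-≗ : ∀ {e n cfg b b′} → Realises e n cfg b → b ≗ b′ → Realises e n cfg b′
realises-≗ (empty b≡[]) b≗b′ = empty λ r → trans (sym (b≗b′ r)) (b≡[] r)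
realises-≗ (onto a sub b≗) b≗b′ = onto a sub λ r → trans (sym (b≗b′ r)) (b≗ r)

all-only : ∀ {P : Disk → Set} p x r → (r ≡ p → P x) → All P (only p x r)
all-only p x r h with r ≟ᵖ p
... | yes r≡p = h r≡p ∷ []
... | no _ = []

realises-disks : ∀ {e n cfg b} → Realises e n cfg b → ∀ r → All (DiskOK e n r) (b r)
realises-disks (empty b≡[]) r rewrite b≡[] r = []
realises-disks {e} (onto {n = n} {p} {c} a sub b≗) r rewrite b≗ r =
  ++⁺ (All.map (λ (d<n , a′) → m<n⇒m<1+n d<n , accepts-restrict⁻ e a a′) (realises-disks sub r))
      (all-only p (n , c) r λ { refl → n<1+n n , a })

realises-top : ∀ {e n cfg b r d c l} → Realises e n cfg b → b r ≡ (d , c) ∷ l → d < n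
realises-top {r = r} sub b-r = proj₁ (All.head (subst (All (DiskOK _ _ r)) b-r (realises-disks sub r)))

realises-tower : ∀ n e g → Accepts e g → Realises e n (replicate n g) (towerBoard n g)
realises-tower zero e g a = empty λ _ → refl
realises-tower (suc n) e g a = onto a (realises-tower n (restrict e g) g (accepts-restrict-self e a)) λ _ → refl

realises-tower⁻ : ∀ {e n cfg b} g → Realises e n cfg b → b ≗ towerBoard n g → cfg ≡ replicate n g
realises-tower⁻ g (empty _) _ = refl
realises-tower⁻ {n = suc n} (p , c) (onto {p = p₀} {b₀ = b₀} a sub b≗) b≗t with p₀ ≟ᵖ p
... | no p₀≢p = contradiction (trans (sym (b≗ p₀)) (trans (b≗t p₀) (towerBoard-≢ (suc n) c p₀≢p)))
                              (beneath-nonempty p₀ _ b₀)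
... | yes refl with beneath-injective (λ r → trans (sym (b≗ r)) (b≗t r))
... | b₀≗t , refl = cong ((p , c) ∷ᵛ_) (realises-tower⁻ (p , c) sub b₀≗t)

other : (p q : Post) → ∃[ w ] w ≢ p × w ≢ q
other S S = I , (λ ()) , (λ ())
other S I = D , (λ ()) , (λ ())
other S D = I , (λ ()) , (λ ())
other I S = D , (λ ()) , (λ ())
other I I = S , (λ ()) , (λ ())
other I D = S , (λ ()) , (λ ())
other D S = I , (λ ()) , (λ ())
other D I = S , (λ ()) , (λ ())
other D D = S , (λ ()) , (λ ())

other-unique : (p q w w′ : Post) → p ≢ q → w ≢ p → w ≢ q → w′ ≢ p → w′ ≢ q → w ≡ w′
other-unique = toWitness {a? = ∀-Post? λ p → ∀-Post? λ q → ∀-Post? λ w → ∀-Post? λ w′ →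
  ¬? (p ≟ᵖ q) →-dec ¬? (w ≟ᵖ p) →-dec ¬? (w ≟ᵖ q) →-dec ¬? (w′ ≟ᵖ p) →-dec ¬? (w′ ≟ᵖ q) →-dec
  w ≟ᵖ w′} _

accepted-colour : ∀ e w → ∃[ c ] Accepts e (w , c)
accepted-colour e S = Red , refl
accepted-colour nothing I = Red , _
accepted-colour (just c) I = c , refl
accepted-colour e D = Blue , refl

gathered : ∀ {e n cfg b p q} → Realises e n cfg b → p ≢ q → b p ≡ [] → b q ≡ [] →
           ∃[ w ] ∃[ cw ] w ≢ p × w ≢ q × Accepts e (w , cw) × cfg ≡ replicate n (w , cw)
gathered {e} {p = p} {q} (empty _) _ _ _ with other p q | accepted-colour e (proj₁ (other p q))
... | w , w≢p , w≢q | cw , a = w , cw , w≢p , w≢q , a , refl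
gathered {e} {p = p} {q} (onto {p = p₁} {c₁} {b₀ = b₀} a sub b≗) p≢q bp bq
  with gathered sub p≢q (++-conicalˡ (b₀ p) _ (trans (sym (b≗ p)) bp))
                        (++-conicalˡ (b₀ q) _ (trans (sym (b≗ q)) bq))
... | w , cw , w≢p , w≢q , a′ , refl with other-unique p q w p₁ p≢q w≢p w≢q p₁≢p p₁≢q
  where
  p₁≢p : p₁ ≢ p
  p₁≢p refl = beneath-nonempty p₁ _ b₀ (trans (sym (b≗ p)) bp)
  p₁≢q : p₁ ≢ q
  p₁≢q refl = beneath-nonempty p₁ _ b₀ (trans (sym (b≗ q)) bq)
... | refl rewrite accepts-restrict-same e a a′ = w , c₁ , w≢p , w≢q , a , refl

data Transition : Env → (n : ℕ) → Vec Place n → Vec Place n → Set where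
  inner : ∀ {e n L cfg cfg′} → Transition (restrict e L) n cfg cfg′ → Transition e (suc n) (L ∷ᵛ cfg) (L ∷ᵛ cfg′)
  outer : ∀ {e n p c w cw q} → Accepts e (p , c) → LargestMove e (p , c) w q → Accepts (restrict e (p , c)) (w , cw) →
          Transition e (suc n) ((p , c) ∷ᵛ replicate n (w , cw)) ((q , flip c) ∷ᵛ replicate n (w , cw))

realises-replicate-env : ∀ {e e′} n {w cw b} → (∀ c → Accepts e (w , c) → Accepts e′ (w , c)) →
                         Realises e n (replicate n (w , cw)) b → Realises e′ n (replicate n (w , cw)) b
realises-replicate-env zero f (empty b≡[]) = empty b≡[]
realises-replicate-env {e} {e′} (suc n) {w} {cw} f (onto a sub b≗) =
  onto (f cw a) (realises-replicate-env n f′ sub) b≗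
  where
  f′ : ∀ c → Accepts (restrict e (w , cw)) (w , c) → Accepts (restrict e′ (w , cw)) (w , c)
  f′ c h rewrite accepts-restrict-same e a h = accepts-restrict-self e′ (f cw a)

move-above : ∀ {e p c n b₀ b b′ x xs} → Accepts e (p , c) → (∀ r → All (DiskOK (restrict e (p , c)) n r) (b₀ r)) →
             b ≗ beneath p (n , c) b₀ → (m : BoardMove e b b′) → b₀ (BoardMove.from m) ≡ x ∷ xs →
             ∃[ b₀′ ] BoardMove (restrict e (p , c)) b₀ b₀′ × b′ ≗ beneath p (n , c) b₀′
move-above {e} {p} {c} {n} {b₀} {b} {b′} {x} {xs} a ok b≗ m b₀-from = b₀′ , m₀ , b′≗
  where
  open BoardMove m
  split : x ≡ (size , colour) × xs ++ only p (n , c) from ≡ below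
  split = ∷-injective (trans (cong (_++ only p (n , c) from) (sym b₀-from)) (trans (sym (b≗ from)) lifted))
  b₀′ : Board
  b₀′ = (b₀ [ from ≔ xs ]) [ to ≔ (size , flip colour) ∷ b₀ to ]
  m₀ : BoardMove (restrict e (p , c)) b₀ b₀′
  m₀ = record
    { from≢to = from≢to
    ; lifted = trans b₀-from (cong (_∷ xs) (proj₁ split))
    ; fits = fits-beneath⁻ e (b₀ to) a (ok to) (subst (Fits e to _) (b≗ to) fits)
    ; at-from = trans ([≔]-≢ _ _ from≢to) ([≔]-≡ b₀ from xs)
    ; at-to = [≔]-≡ _ to _
    ; elsewhere = λ r r≢f r≢t → trans ([≔]-≢ _ _ r≢t) ([≔]-≢ b₀ xs r≢f)
    }
  b′≗ : b′ ≗ beneath p (n , c) b₀′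
  b′≗ r with r ≟ᵖ to
  ... | yes refl = trans at-to (cong (_ ∷_) (b≗ r))
  ... | no r≢t with r ≟ᵖ from
  ...   | yes refl = trans at-from (sym (proj₂ split))
  ...   | no r≢f = trans (elsewhere r r≢f r≢t) (b≗ r)

fits-largest⇒empty : ∀ {e e′ n cfg b₀ q c} → Realises e′ n cfg b₀ → Fits e q (n , c) (b₀ q) → b₀ q ≡ []
fits-largest⇒empty {b₀ = b₀} {q} sub fits with b₀ q in b₀-q
... | [] = refl
... | (_ , _) ∷ _ = contradiction (realises-top sub b₀-q) (<-asym (proj₁ (proj₂ fits)))

move-largest : ∀ {e p c n cfg b₀ b b′} → Accepts e (p , c) → Realises (restrict e (p , c)) n cfg b₀ →
               b ≗ beneath p (n , c) b₀ → (m : BoardMove e b b′) → b₀ (BoardMove.from m) ≡ [] →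
               ∃[ cfg′ ] Realises e (suc n) cfg′ b′ × Transition e (suc n) ((p , c) ∷ᵛ cfg) cfg′
move-largest {e} {p} {c} {n} {b₀ = b₀} {b} {b′} a sub b≗
             (boardMove p′ q d col below p′≢q lifted fits at-from at-to elsewhere) b₀-from
  with p′ ≟ᵖ p
... | no p′≢p = contradiction (trans (sym lifted) (trans (b≗ p′) (trans (beneath-≢ _ b₀ p′≢p) b₀-from))) λ ()
... | yes refl with ∷-injective (trans (sym lifted) (trans (b≗ p) (cong₂ _++_ b₀-from (only-≡ p (n , c)))))
... | refl , refl with fits-largest⇒empty sub (subst (Fits e q (n , flip c)) (trans (b≗ q) (beneath-≢ _ b₀ (≢-sym p′≢q))) fits)
... | b₀-to with gathered sub p′≢q b₀-from b₀-to
... | w , cw , w≢p , w≢q , acc , refl =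
  (q , flip c) ∷ᵛ replicate n (w , cw) , onto accepts-q sub′ b′≗ , outer a (q≢p , w≢p , w≢q , accepts-q) acc
  where
  q≢p : q ≢ p
  q≢p = ≢-sym p′≢q
  b-q : b q ≡ []
  b-q = trans (b≗ q) (trans (beneath-≢ _ b₀ q≢p) b₀-to)
  accepts-q : Accepts e (q , flip c)
  accepts-q = subst (Fits e q (n , flip c)) b-q fits
  sub′ : Realises (restrict e (q , flip c)) n (replicate n (w , cw)) b₀
  sub′ = realises-replicate-env n (λ c′ → accepts-restrict-swap e c (flip c) c′ w≢p w≢q) sub
  b′≗ : b′ ≗ beneath q (n , flip c) b₀
  b′≗ r with r ≟ᵖ q
  ... | yes refl = trans at-to (trans (cong (_ ∷_) b-q) (cong (_++ _) (sym b₀-to)))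
  ... | no r≢q with r ≟ᵖ p
  ...   | yes refl = trans at-from (sym (cong (_++ []) b₀-from))
  ...   | no r≢p =
    trans (elsewhere r r≢p r≢q) (trans (b≗ r) (trans (beneath-≢ _ b₀ r≢p) (sym (++-identityʳ (b₀ r)))))

realise-move : ∀ {e n cfg b b′} → Realises e n cfg b → BoardMove e b b′ →
               ∃[ cfg′ ] Realises e n cfg′ b′ × Transition e n cfg cfg′
realise-move (empty b≡[]) m = contradiction (trans (sym (b≡[] (BoardMove.from m))) (BoardMove.lifted m)) λ ()
realise-move (onto {b₀ = b₀} a sub b≗) m with b₀ (BoardMove.from m) in b₀-from
... | _ ∷ _ with move-above a (realises-disks sub) b≗ m b₀-from
...   | b₀′ , m₀ , b′≗ with realise-move sub m₀
...     | cfg′ , sub′ , t = _ , onto a sub′ b′≗ , inner t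
realise-move (onto a sub b≗) m | [] = move-largest a sub b≗ m b₀-from

lift-move : ∀ {e p c n cfg b₀ b₀′} → Accepts e (p , c) → Realises (restrict e (p , c)) n cfg b₀ →
            BoardMove (restrict e (p , c)) b₀ b₀′ → BoardMove e (beneath p (n , c) b₀) (beneath p (n , c) b₀′)
lift-move {e} {p} {c} {n} {b₀ = b₀} a sub (boardMove f t d col below f≢t lifted fits at-from at-to elsewhere) =
  boardMove f t d col (below ++ only p (n , c) f) f≢t (cong (_++ _) lifted)
    (fits-beneath⁺ e (b₀ t) a (realises-top sub lifted) fits) (cong (_++ _) at-from) (cong (_++ _) at-to)
    λ r r≢f r≢t → cong (_++ _) (elsewhere r r≢f r≢t)

lift-path : ∀ {e p c n cfg b₀ b₀′ k} → Accepts e (p , c) → Realises (restrict e (p , c)) n cfg b₀ →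
            BoardPath (restrict e (p , c)) b₀ b₀′ k → BoardPath e (beneath p (n , c) b₀) (beneath p (n , c) b₀′) k
lift-path a sub done = done
lift-path a sub (step m path) = step (lift-move a sub m) (lift-path a (proj₁ (proj₂ (realise-move sub m))) path)

withLargest : ℕ → Place → Place → Board
withLargest n (p , c) t = beneath p (n , c) (towerBoard n t)

largest-step : ∀ {e} n {p c w cw q} → LargestMove e (p , c) w q →
               BoardMove e (withLargest n (p , c) (w , cw)) (withLargest n (q , flip c) (w , cw))
largest-step {e} n {p} {c} {w} {cw} {q} (q≢p , w≢p , w≢q , accepts-q) =
  boardMove p q n c [] (≢-sym q≢p) (trans (cong (_++ only p (n , c) p) tower-p) (only-≡ p (n , c)))
    (subst (Fits e q (n , flip c)) (sym below-q) accepts-q)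
    (trans (beneath-≢ (n , flip c) T (≢-sym q≢p)) tower-p)
    (trans (cong (_++ only q (n , flip c) q) tower-q) (trans (only-≡ q (n , flip c)) (cong (_ ∷_) (sym below-q))))
    λ r r≢p r≢q → trans (beneath-≢ (n , flip c) T r≢q) (sym (beneath-≢ (n , c) T r≢p))
  where
  T : Board
  T = towerBoard n (w , cw)
  tower-p : T p ≡ []
  tower-p = towerBoard-≢ n cw (≢-sym w≢p)
  tower-q : T q ≡ []
  tower-q = towerBoard-≢ n cw (≢-sym w≢q)
  below-q : beneath p (n , c) T q ≡ []
  below-q = trans (beneath-≢ (n , c) T q≢p) tower-q

mutual
  towerPath : ∀ n e s g → Accepts e s → Accepts e g →
              BoardPath e (towerBoard n s) (towerBoard n g) (⟦ towerCost e s g ⟧ n)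
  towerPath zero e s g _ _ =
    subst (BoardPath e _ _) (sym (trans (⟦⟧-zero (towerCost e s g)) (towerCost-constant e s g))) done
  towerPath (suc n) e s g as ag with towerPlan-correct e s g as ag
  ... | runs , cost≡ =
    subst (BoardPath e _ _) (trans (cong (λ f → ⟦ f ⟧ n) cost≡) (⟦⟧-shift (towerCost e s g) n))
          (runPlan n e s s (towerPlan e s g) g g runs as (accepts-restrict-self e as))

  runPlan : ∀ n e L t ps L′ t′ → Runs e L t ps L′ t′ → Accepts e L → Accepts (restrict e L) t →
            BoardPath e (withLargest n L t) (withLargest n L′ t′) (⟦ planCost e L t ps ⟧ n)
  runPlan n e L t [] L′ t′ (refl , refl) _ _ = done
  runPlan n e L t (gather t′ ∷ ps) L″ t″ (at′ , runs) aL at =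
    subst (BoardPath e _ _) (sym (⟦⟧-⊕ (towerCost (restrict e L) t t′) (planCost e L t′ ps) n))
      (lift-path aL (realises-tower n _ t at) (towerPath n (restrict e L) t t′ at at′)
       ++ᵖ runPlan n e L t′ ps L″ t″ runs aL at′)
  runPlan n e (p , c) (w , cw) (largest q ∷ ps) L′ t′ (lm@(_ , w≢p , w≢q , accepts-q) , runs) _ at =
    subst (BoardPath e _ _) (sym (⟦⟧-⊕ 1ₐ (planCost e (q , flip c) (w , cw) ps) n))
      (step (largest-step n lm)
            (runPlan n e (q , flip c) (w , cw) ps L′ t′ runs accepts-q
                     (accepts-restrict-swap e c (flip c) cw w≢p w≢q at)))

accepted : Env → List Place
accepted e = (S , Red) ∷ (D , Blue) ∷ acceptedOnI e
  where
  acceptedOnI : Env → List Place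
  acceptedOnI nothing = (I , Red) ∷ (I , Blue) ∷ []
  acceptedOnI (just c) = (I , c) ∷ []

accepted-complete : ∀ e {t} → Accepts e t → t ∈ accepted e
accepted-complete e {S , Red} _ = here refl
accepted-complete e {D , Blue} _ = there (here refl)
accepted-complete nothing {I , Red} _ = there (there (here refl))
accepted-complete nothing {I , Blue} _ = there (there (there (here refl)))
accepted-complete (just c) {I , .c} refl = there (there (here refl))

accepted-sound : ∀ e → All (Accepts e) (accepted e)
accepted-sound nothing = refl ∷ refl ∷ _ ∷ _ ∷ []
accepted-sound (just c) = refl ∷ refl ∷ refl ∷ []

-- Opaque: unfolding the argmin inside Φ makes type checking blow up.
opaque
  best : (Place → ℕ) → Env → Place
  best f e = argmin f (S , Red) (accepted e)

  best-≤ : (f : Place → ℕ) (e : Env) {t : Place} → Accepts e t → f (best f e) ≤ f t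
  best-≤ f e at = All.lookup (f[argmin]≤f[xs] {f = f} (S , Red) (accepted e)) (accepted-complete e at)

  best-accepted : (f : Place → ℕ) (e : Env) → Accepts e (best f e)
  best-accepted f e = argmin-all f {P = Accepts e} refl (accepted-sound e)

-- Φ n e g cfg is a lower bound for the number of moves from cfg to the n-tower at g: the smaller
-- disks are first gathered at the best place t.
mutual
  Φ : (n : ℕ) → Env → Place → Vec Place n → ℕ
  Φ zero _ _ []ᵛ = 0
  Φ (suc n) e g (L ∷ᵛ cfg) = Φ-via n e g L cfg (best (Φ-via n e g L cfg) (restrict e L))

  Φ-via : (n : ℕ) → Env → Place → Place → Vec Place n → Place → ℕ
  Φ-via n e g L cfg t = Φ n (restrict e L) t cfg + ⟦ finishCost e g L t ⟧ n

Φ-≤-via : ∀ n e g L cfg {t} → Accepts (restrict e L) t → Φ (suc n) e g (L ∷ᵛ cfg) ≤ Φ-via n e g L cfg t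
Φ-≤-via n e g L cfg = best-≤ (Φ-via n e g L cfg) (restrict e L)

Φ-attained : ∀ n e g L cfg → ∃[ t ] Accepts (restrict e L) t × Φ (suc n) e g (L ∷ᵛ cfg) ≡ Φ-via n e g L cfg t
Φ-attained n e g L cfg = _ , best-accepted (Φ-via n e g L cfg) (restrict e L) , refl

Φ-goal : ∀ n e g → Accepts e g → Φ n e g (replicate n g) ≡ 0
Φ-goal zero e g _ = refl
Φ-goal (suc n) e g ag = n≤0⇒n≡0 (begin
  Φ (suc n) e g (replicate (suc n) g)                         ≤⟨ Φ-≤-via n e g g _ ag′ ⟩
  Φ n (restrict e g) g (replicate n g) + ⟦ finishCost e g g g ⟧ n
    ≡⟨ cong₂ _+_ (Φ-goal n (restrict e g) g ag′) (cong (λ f → ⟦ f ⟧ n) (finishCost-done e g ag)) ⟩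
  0                                                           ∎)
  where
  open ≤-Reasoning
  ag′ : Accepts (restrict e g) g
  ag′ = accepts-restrict-self e ag

Φ-tower : ∀ n e s g → Accepts e s → Accepts e g → ⟦ towerCost e s g ⟧ n ≤ Φ n e g (replicate n s)
Φ-tower zero e s g _ _ = ≤-reflexive (trans (⟦⟧-zero (towerCost e s g)) (towerCost-constant e s g))
Φ-tower (suc n) e s g as ag with Φ-attained n e g s (replicate n s)
... | t , at , Φ≡ = begin
  ⟦ towerCost e s g ⟧ (suc n)                     ≡⟨ sym (⟦⟧-shift (towerCost e s g) n) ⟩
  ⟦ shift (towerCost e s g) ⟧ n                   ≤⟨ ⟦⟧-mono _ _ (finishCost-split e g s t ag as at) n ⟩
  ⟦ towerCost e′ s t ⊕ F ⟧ n                      ≡⟨ ⟦⟧-⊕ (towerCost e′ s t) F n ⟩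
  ⟦ towerCost e′ s t ⟧ n + ⟦ F ⟧ n                ≤⟨ +-monoˡ-≤ _ (Φ-tower n e′ s t (accepts-restrict-self e as) at) ⟩
  Φ-via n e g s (replicate n s) t                 ≡⟨ sym Φ≡ ⟩
  Φ (suc n) e g (replicate (suc n) s)             ∎
  where
  open ≤-Reasoning
  e′ : Env
  e′ = restrict e s
  F : Affine
  F = finishCost e g s t

Φ-transition : ∀ {e n cfg cfg′} g → Accepts e g → Transition e n cfg cfg′ → Φ n e g cfg ≤ suc (Φ n e g cfg′)
Φ-transition {e} {suc n} {L ∷ᵛ cfg} {_ ∷ᵛ cfg′} g ag (inner tr) with Φ-attained n e g L cfg′
... | t , at , Φ≡ = begin
  Φ (suc n) e g (L ∷ᵛ cfg)                                  ≤⟨ Φ-≤-via n e g L cfg at ⟩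
  Φ n (restrict e L) t cfg + ⟦ finishCost e g L t ⟧ n       ≤⟨ +-monoˡ-≤ _ (Φ-transition t at tr) ⟩
  suc (Φ-via n e g L cfg′ t)                                ≡⟨ cong suc (sym Φ≡) ⟩
  suc (Φ (suc n) e g (L ∷ᵛ cfg′))                           ∎
  where open ≤-Reasoning
Φ-transition {e} {suc n} g ag (outer {p = p} {c} {w} {cw} {q} ap lm@(_ , w≢p , w≢q , _) aw)
  with Φ-attained n e g (q , flip c) (replicate n (w , cw))
... | t , at , Φ≡ = begin
  Φ (suc n) e g ((p , c) ∷ᵛ rep)
    ≤⟨ Φ-≤-via n e g (p , c) rep aw ⟩
  Φ n (restrict e (p , c)) (w , cw) rep + ⟦ F₁ ⟧ n
    ≡⟨ cong (_+ ⟦ F₁ ⟧ n) (Φ-goal n (restrict e (p , c)) (w , cw) aw) ⟩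
  ⟦ F₁ ⟧ n
    ≤⟨ ⟦⟧-mono _ _ (finishCost-largest e g p c w cw q t ag ap aw lm at) n ⟩
  ⟦ 1ₐ ⊕ towerCost e₂ (w , cw) t ⊕ F₂ ⟧ n
    ≡⟨ ⟦⟧-⊕ 1ₐ (towerCost e₂ (w , cw) t ⊕ F₂) n ⟩
  suc (⟦ towerCost e₂ (w , cw) t ⊕ F₂ ⟧ n)
    ≡⟨ cong suc (⟦⟧-⊕ (towerCost e₂ (w , cw) t) F₂ n) ⟩
  suc (⟦ towerCost e₂ (w , cw) t ⟧ n + ⟦ F₂ ⟧ n)
    ≤⟨ s≤s (+-monoˡ-≤ _ (Φ-tower n e₂ (w , cw) t aw₂ at)) ⟩
  suc (Φ-via n e g (q , flip c) rep t)
    ≡⟨ cong suc (sym Φ≡) ⟩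
  suc (Φ (suc n) e g ((q , flip c) ∷ᵛ rep))
    ∎
  where
  open ≤-Reasoning
  rep : Vec Place n
  rep = replicate n (w , cw)
  e₂ : Env
  e₂ = restrict e (q , flip c)
  F₁ F₂ : Affine
  F₁ = finishCost e g (p , c) (w , cw)
  F₂ = finishCost e g (q , flip c) t
  aw₂ : Accepts e₂ (w , cw)
  aw₂ = accepts-restrict-swap e c (flip c) cw w≢p w≢q aw

Φ-path : ∀ {e n cfg b b′ k} g → Accepts e g → Realises e n cfg b → BoardPath e b b′ k →
         ∃[ cfg′ ] Realises e n cfg′ b′ × Φ n e g cfg ≤ k + Φ n e g cfg′
Φ-path g ag r done = _ , r , ≤-refl
Φ-path g ag r (step m path) with realise-move r m
... | _ , r₁ , tr with Φ-path g ag r₁ path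
...   | cfg′ , r′ , Φ≤ = cfg′ , r′ , ≤-trans (Φ-transition g ag tr) (s≤s Φ≤)

towerCost-lower-bound : ∀ {e} n {s g b b′ k} → Accepts e s → Accepts e g → b ≗ towerBoard n s → b′ ≗ towerBoard n g →
                        BoardPath e b b′ k → ⟦ towerCost e s g ⟧ n ≤ k
towerCost-lower-bound {e} n {s} {g} {k = k} as ag b≗ b′≗ path
  with Φ-path g ag (realises-≗ (realises-tower n e s as) (λ r → sym (b≗ r))) path
... | cfg′ , r′ , Φ≤ with realises-tower⁻ g r′ b′≗
... | refl = begin
  ⟦ towerCost e s g ⟧ n           ≤⟨ Φ-tower n e s g as ag ⟩
  Φ n e g (replicate n s)         ≤⟨ Φ≤ ⟩
  k + Φ n e g (replicate n g)     ≡⟨ cong (k +_) (Φ-goal n e g ag) ⟩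
  k + 0                           ≡⟨ +-identityʳ k ⟩
  k                               ∎
  where open ≤-Reasoning

toBoard : State → Board
toBoard st r = stackOf r st

setStack-≔ : ∀ q l st → toBoard (setStack q l st) ≗ toBoard st [ q ≔ l ]
setStack-≔ S _ _ S = refl
setStack-≔ S _ _ I = refl
setStack-≔ S _ _ D = refl
setStack-≔ I _ _ S = refl
setStack-≔ I _ _ I = refl
setStack-≔ I _ _ D = refl
setStack-≔ D _ _ S = refl
setStack-≔ D _ _ I = refl
setStack-≔ D _ _ D = refl

Fits-nothing : ∀ q x l → Fits nothing q x l ≡ CanPlace q x l
Fits-nothing S _ [] = refl
Fits-nothing S _ (_ ∷ _) = refl
Fits-nothing I _ [] = refl
Fits-nothing I _ (_ ∷ _) = refl
Fits-nothing D _ [] = refl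
Fits-nothing D _ (_ ∷ _) = refl

fromMove : ∀ {st st′} → Move st st′ → BoardMove nothing (toBoard st) (toBoard st′)
fromMove (move st p q d c rest p≢q lifted fits) =
  boardMove p q d c rest p≢q lifted (subst id (sym (Fits-nothing q (d , flip c) (stackOf q st))) fits)
    (trans (setStack-≔ q _ _ p) (trans ([≔]-≢ _ _ p≢q)
      (trans (setStack-≔ p rest st p) ([≔]-≡ _ p rest))))
    (trans (setStack-≔ q _ _ q) ([≔]-≡ _ q _))
    λ r r≢p r≢q → trans (setStack-≔ q _ _ r) (trans ([≔]-≢ _ _ r≢q)
      (trans (setStack-≔ p rest st r) ([≔]-≢ _ rest r≢p)))

fromPath : ∀ {st st′ k} → Path st st′ k → BoardPath nothing (toBoard st) (toBoard st′) k
fromPath done = done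
fromPath (step m path) = step (fromMove m) (fromPath path)

toBoard-injective : ∀ {st st′} → toBoard st ≗ toBoard st′ → st ≡ st′
toBoard-injective {⟨ _ , _ , _ ⟩} {⟨ _ , _ , _ ⟩} h with h S | h I | h D
... | refl | refl | refl = refl

toPath : ∀ {b b′ k} st st′ → BoardPath nothing b b′ k → toBoard st ≗ b → toBoard st′ ≗ b′ → Path st st′ k
toPath st st′ done st≗ st′≗ rewrite toBoard-injective (λ r → trans (st≗ r) (sym (st′≗ r))) = done
toPath st st′ (step {b′ = b₁} (boardMove p q d c below p≢q lifted fits at-from at-to elsewhere) path) st≗ st′≗ =
  step (move st p q d c below p≢q (trans (st≗ p) lifted) fits′) (toPath _ st′ path next st′≗)
  where
  fits′ : CanPlace q (d , flip c) (stackOf q st)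
  fits′ = subst id (Fits-nothing q (d , flip c) (stackOf q st))
                   (subst (Fits nothing q (d , flip c)) (sym (st≗ q)) fits)
  next : toBoard (setStack q ((d , flip c) ∷ stackOf q st) (setStack p below st)) ≗ b₁
  next r with r ≟ᵖ q
  ... | yes refl = trans (setStack-≔ r _ _ r) (trans ([≔]-≡ _ r _) (trans (cong (_ ∷_) (st≗ r)) (sym at-to)))
  ... | no r≢q with r ≟ᵖ p
  ...   | yes refl = trans (setStack-≔ q _ _ r) (trans ([≔]-≢ _ _ r≢q)
                       (trans (setStack-≔ r below st r) (trans ([≔]-≡ _ r below) (sym at-from))))
  ...   | no r≢p = trans (setStack-≔ q _ _ r) (trans ([≔]-≢ _ _ r≢q) (trans (setStack-≔ p below st r)
                     (trans ([≔]-≢ _ below r≢p) (trans (st≗ r) (sym (elsewhere r r≢p r≢q))))))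

towerBoard-same : ∀ n p c → towerBoard n (p , c) p ≡ tower n c
towerBoard-same zero p c = refl
towerBoard-same (suc n) p c = begin
  towerBoard n (p , c) p ++ only p (n , c) p     ≡⟨ cong₂ _++_ (towerBoard-same n p c) (only-≡ p (n , c)) ⟩
  map (λ i → (i , c)) (upTo n) ++ [ (n , c) ]    ≡⟨ sym (map-++ (λ i → (i , c)) (upTo n) [ n ]) ⟩
  map (λ i → (i , c)) (upTo n ++ [ n ])          ≡⟨ cong (map (λ i → (i , c))) (upTo-∷ʳ n) ⟩
  tower (suc n) c                                ∎
  where open ≡-Reasoning

mainTheorem3 : ∀ (N : ℕ) → 1 ≤ N → MinMoves (startState N) (endState N) (S727 N)
mainTheorem3 N _ =
    subst (Path _ _) cost≡ (toPath _ _ (towerPath N nothing (S , Red) (D , Blue) refl refl) start≗ end≗)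
  , λ m path → subst (_≤ m) cost≡ (towerCost-lower-bound N refl refl start≗ end≗ (fromPath path))
  where
  cost≡ : ⟦ towerCost nothing (S , Red) (D , Blue) ⟧ N ≡ S727 N
  cost≡ = trans (identity (β₁ N) (β₂ N) (β₃ N) (β₄ N) (β₅ N)) (sym (S727≡β N))
    where
    identity : ∀ x w u v z → 0 + 1 * x + 1 * w + 0 * u + 0 * v + 0 * z ≡ x + w
    identity = solve-∀
  start≗ : toBoard (startState N) ≗ towerBoard N (S , Red)
  start≗ S = sym (towerBoard-same N S Red)
  start≗ I = sym (towerBoard-≢ N Red λ ())
  start≗ D = sym (towerBoard-≢ N Red λ ())
  end≗ : toBoard (endState N) ≗ towerBoard N (D , Blue)
  end≗ S = sym (towerBoard-≢ N Blue λ ())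
  end≗ I = sym (towerBoard-≢ N Blue λ ())
  end≗ D = sym (towerBoard-same N D Blue)
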